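{- Let $q$ be a prime power, $n\in\mathbb{N}$, $r\in\{1,\dots,n-1\}$, and $0<\varepsilon<\delta<1$. If $K\subset\mathbb{F}_q^n$ is an $\varepsilon$-Kakeya set of rank $r$, then there exists a $\delta$-Kakeya set $\mathcal{A}\subset\mathbb{F}_q^n$ of rank $r$ with $$|\mathcal{A}| \le \left\lceil \frac{\log(1-\delta)}{\log(1-\varepsilon)}\right\rceil |K| .$$
   Context: $\mathbb{F}_q$ is the field with $q$ elements and $\mathrm{Gr}_{n,r}(\mathbb{F}_q)$ the set of $r$-dimensional linear subspaces of $\mathbb{F}_q^n$. For $\varepsilon\in(0,1]$, a set $K\subset\mathbb{F}_q^n$ is an $\varepsilon$-Kakeya set of rank $r$ if $|\{S\in\mathrm{Gr}_{n,r}(\mathbb{F}_q) : \exists x\in\mathbb{F}_q^n,\ x+S\subset K\}| \ge \varepsilon\, |\mathrm{Gr}_{n,r}(\mathbb{F}_q)|$.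
   Formalization: The parameters ε and δ range over the rationals. -}

module Defs where

open import Level using (0ℓ)
open import Data.Nat as ℕ using (ℕ; zero; suc)
open import Data.Fin using (Fin; zero; suc)
open import Data.Vec using (Vec; zipWith; replicate; map)
open import Data.Bool using (Bool; true)
open import Data.Product using (Σ; ∃; _×_; _,_)
open import Data.Integer using (+_)
open import Data.Rational as ℚ using (ℚ; 1ℚ; _≤_)
open import Function using (_∘_; _⇔_)
open import Function.Bundles using (_↔_)
open import Relation.Binary.PropositionalEquality using (_≡_; _≢_)
open import Algebra.Structures using (IsCommutativeRing)

-- A finite field with exactly q elements (q is then necessarily a prime
-- power, and every prime power q arises; F is "F_q").

record FiniteField : Set₁ where
  field
    F          : Set
    _+_ _*_    : F → F → F
    -_         : F → F
    0# 1#      : F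
    isCommRing : IsCommutativeRing _≡_ _+_ _*_ -_ 0# 1#
    0≢1        : 0# ≢ 1#
    inverse    : ∀ x → x ≢ 0# → ∃ λ y → x * y ≡ 1#
    q          : ℕ
    enum       : Fin q ↔ F

-- Finite cardinality of the elements of A satisfying P, counted up to
-- an equivalence _≈_ on A (used for subsets given as Bool-valued
-- functions, which are identified when pointwise equal).

record HasSize {A : Set} (_≈_ : A → A → Set) (P : A → Set) (k : ℕ) : Set where
  field
    elt        : Fin k → A
    elt-in     : ∀ i → P (elt i)
    elt-inj    : ∀ i j → elt i ≈ elt j → i ≡ j
    elt-onto   : ∀ a → P a → ∃ λ i → elt i ≈ a

module _ (𝔽 : FiniteField) where
  open FiniteField 𝔽

  Pt : ℕ → Set
  Pt n = Vec F n

  Subset : ℕ → Set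
  Subset n = Pt n → Bool

  _∈_ : ∀ {n} → Pt n → Subset n → Set
  x ∈ S = S x ≡ true

  _≐_ : ∀ {n} → Subset n → Subset n → Set
  S ≐ T = ∀ x → S x ≡ T x

  _⊕_ : ∀ {n} → Pt n → Pt n → Pt n
  _⊕_ = zipWith _+_

  _•_ : ∀ {n} → F → Pt n → Pt n
  c • v = map (c *_) v

  𝟎 : ∀ {n} → Pt n
  𝟎 = replicate _ 0#

  lincomb : ∀ {n r} → (Fin r → F) → (Fin r → Pt n) → Pt n
  lincomb {r = zero}  c v = 𝟎
  lincomb {r = suc r} c v = (c zero • v zero) ⊕ lincomb (c ∘ suc) (v ∘ suc)

  LinIndep : ∀ {n r} → (Fin r → Pt n) → Set
  LinIndep v = ∀ c → lincomb c v ≡ 𝟎 → ∀ i → c i ≡ 0#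

  IsGr : (n r : ℕ) → Subset n → Set
  IsGr n r S = Σ (Fin r → Pt n) λ v →
    LinIndep v × (∀ x → (x ∈ S) ⇔ (∃ λ c → lincomb c v ≡ x))

  TranslateIn : ∀ {n} → Subset n → Subset n → Set
  TranslateIn S K = ∃ λ x → ∀ y → y ∈ S → (x ⊕ y) ∈ K

  ℕ→ℚ : ℕ → ℚ
  ℕ→ℚ k = + k ℚ./ 1

  IsKakeya : (n r : ℕ) → ℚ → Subset n → Set
  IsKakeya n r ε K = Σ ℕ λ g → Σ ℕ λ c →
    HasSize _≐_ (IsGr n r) g ×
    HasSize _≐_ (λ S → IsGr n r S × TranslateIn S K) c ×
    (ε ℚ.* ℕ→ℚ g ≤ ℕ→ℚ c)

  Card : ∀ {n} → Subset n → ℕ → Set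
  Card K k = HasSize _≡_ (_∈ K) k

_^ℚ_ : ℚ → ℕ → ℚ
x ^ℚ zero  = 1ℚ
x ^ℚ suc m = x ℚ.* (x ^ℚ m)

-- m = ⌈ log(1-δ) / log(1-ε) ⌉  for 0 < ε < δ < 1.  Since log(1-ε) < 0,
-- m ≥ log(1-δ)/log(1-ε)  ⇔  m·log(1-ε) ≤ log(1-δ)  ⇔  (1-ε)^m ≤ 1-δ,
-- so the ceiling is the least natural m with (1-ε)^m ≤ 1-δ.
IsCeilLogRatio : ℚ → ℚ → ℕ → Set
IsCeilLogRatio ε δ m =
  ((1ℚ ℚ.- ε) ^ℚ m ≤ 1ℚ ℚ.- δ) ×
  (∀ k → k ℕ.< m → ℚ._<_ (1ℚ ℚ.- δ) ((1ℚ ℚ.- ε) ^ℚ k))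

{-# OPTIONS --safe #-}
-- GL_n(F_q) acts transitively on Gr_{n,r}(F_q), so averaging over all invertible M shows that the
-- preimage M⁻¹K contains a translate of a fixed r-subspace for at least an ε-fraction of the M.
-- Hence for every set U of r-subspaces some copy M⁻¹K covers at least ε|U| of them.  Greedily adding
-- m such copies of K leaves at most (1 - ε)^m ≤ 1 - δ of all r-subspaces uncovered, and each copy
-- adds at most |K| points.
module Submission where

open import Defs
open import Data.Nat using (ℕ)
open import Data.Fin using (Fin)
open import Data.Bool using (Bool; true; _∧_)
open import Data.Product using (∃; _,_)
open import Relation.Binary.PropositionalEquality using (_≡_)

module Counting where

  open import Data.Nat using (zero; suc; _+_; _*_; _≤_; _<_; _≤?_; z≤n; s≤s)
  open import Data.Nat.Properties
    using (+-*-semiring; +-identityʳ; *-identityʳ; *-zeroʳ; *-suc; ≤-refl; ≤-reflexive; ≤-trans;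
           <-≤-trans; m≤n+m; <⇒≱; ≰⇒>; +-mono-≤; +-monoˡ-≤; +-cancelʳ-≤; module ≤-Reasoning)
  open import Data.Fin using (zero; suc)
  open import Data.Fin.Properties using (injective⇒≤; any?; suc-injective)
  open import Data.Bool using (false; _∨_; not)
  import Data.Bool
  open import Data.Product using (_×_; proj₁; proj₂)
  open import Data.Empty using (⊥-elim)
  open import Function using (_∘_)
  open import Relation.Nullary using (Dec; does; yes; no; _×-dec_)
  open import Relation.Binary using (IsEquivalence)
  open import Relation.Binary.PropositionalEquality hiding ([_])
  open import Algebra.Properties.Semiring.Sum +-*-semiring public
    using (sum; sum-cong-≗; ∑-comm; ∑-distrib-+; *-distribˡ-sum; *-distribʳ-sum)

  [_] : Bool → ℕ
  [ true ]  = 1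
  [ false ] = 0

  count : ∀ {N} → (Fin N → Bool) → ℕ
  count P = sum ([_] ∘ P)

  sum-mono-≤ : ∀ {N} {f g : Fin N → ℕ} → (∀ i → f i ≤ g i) → sum f ≤ sum g
  sum-mono-≤ {zero}  f≤g = z≤n
  sum-mono-≤ {suc N} f≤g = +-mono-≤ (f≤g zero) (sum-mono-≤ (f≤g ∘ suc))

  sum-const : ∀ N a → sum {N} (λ _ → a) ≡ N * a
  sum-const zero    a = refl
  sum-const (suc N) a = cong (a +_) (sum-const N a)

  [∧] : ∀ a b → [ a ∧ b ] ≡ [ a ] * [ b ]
  [∧] true  b = sym (+-identityʳ [ b ])
  [∧] false b = refl

  count≤N : ∀ {N} (P : Fin N → Bool) → count P ≤ N
  count≤N {N} P = subst (count P ≤_) (trans (sum-const N 1) (*-identityʳ N))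
    (sum-mono-≤ λ i → [≤1] (P i))
    where
    [≤1] : ∀ b → [ b ] ≤ 1
    [≤1] true  = s≤s z≤n
    [≤1] false = z≤n

  count-mono : ∀ {N} {P Q : Fin N → Bool} → (∀ i → P i ≡ true → Q i ≡ true) → count P ≤ count Q
  count-mono {P = P} {Q} P⊆Q = sum-mono-≤ λ i → [mono] (P i) (Q i) (P⊆Q i)
    where
    [mono] : ∀ a b → (a ≡ true → b ≡ true) → [ a ] ≤ [ b ]
    [mono] true  b a⇒b rewrite a⇒b refl = ≤-refl
    [mono] false b a⇒b = z≤n

  count-∨ : ∀ {N} (P Q : Fin N → Bool) → count (λ i → P i ∨ Q i) ≤ count P + count Q
  count-∨ P Q = ≤-trans (sum-mono-≤ λ i → [∨] (P i) (Q i)) (≤-reflexive (∑-distrib-+ ([_] ∘ P) ([_] ∘ Q)))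
    where
    [∨] : ∀ a b → [ a ∨ b ] ≤ [ a ] + [ b ]
    [∨] true  b = s≤s z≤n
    [∨] false b = ≤-refl

  count-split : ∀ {N} (P Q : Fin N → Bool) →
    count (λ i → P i ∧ not (Q i)) + count (λ i → P i ∧ Q i) ≡ count P
  count-split P Q = trans (sym (∑-distrib-+ (λ i → [ P i ∧ not (Q i) ]) (λ i → [ P i ∧ Q i ])))
                          (sum-cong-≗ λ i → [split] (P i) (Q i))
    where
    [split] : ∀ a b → [ a ∧ not b ] + [ a ∧ b ] ≡ [ a ]
    [split] true  true  = refl
    [split] true  false = refl
    [split] false b     = refl

  count-complement : ∀ {N} (P : Fin N → Bool) → count (not ∘ P) + count P ≡ N
  count-complement {N} P = trans (count-split (λ _ → true) P) (trans (sum-const N 1) (*-identityʳ N))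

  count-false : ∀ N → count {N} (λ _ → false) ≡ 0
  count-false N = trans (sum-const N 0) (*-zeroʳ N)

  count-pos : ∀ {N} (P : Fin N → Bool) i → P i ≡ true → 0 < count P
  count-pos P zero    Pi rewrite Pi = s≤s z≤n
  count-pos P (suc i) Pi = <-≤-trans (count-pos (P ∘ suc) i Pi) (m≤n+m _ [ P zero ])

  select : ∀ {N} (P : Fin N → Bool) → Fin (count P) → Fin N
  select {suc N} P k with P zero
  select {suc N} P zero    | true  = zero
  select {suc N} P (suc k) | true  = suc (select (P ∘ suc) k)
  select {suc N} P k       | false = suc (select (P ∘ suc) k)

  select-true : ∀ {N} (P : Fin N → Bool) k → P (select P k) ≡ true
  select-true {suc N} P k with P zero in eq
  select-true {suc N} P zero    | true  = eq
  select-true {suc N} P (suc k) | true  = select-true (P ∘ suc) k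
  select-true {suc N} P k       | false = select-true (P ∘ suc) k

  select-injective : ∀ {N} (P : Fin N → Bool) k k′ → select P k ≡ select P k′ → k ≡ k′
  select-injective {suc N} P k k′ eq with P zero
  select-injective {suc N} P zero    zero     eq | true  = refl
  select-injective {suc N} P (suc k) (suc k′) eq | true  =
    cong suc (select-injective (P ∘ suc) k k′ (suc-injective eq))
  select-injective {suc N} P k       k′       eq | false =
    select-injective (P ∘ suc) k k′ (suc-injective eq)

  select-onto : ∀ {N} (P : Fin N → Bool) i → P i ≡ true → ∃ λ k → select P k ≡ i
  select-onto {suc N} P i Pi with P zero in eq
  select-onto {suc N} P zero    Pi | true  = zero , refl
  select-onto {suc N} P (suc i) Pi | true  = let k , sk≡i = select-onto (P ∘ suc) i Pi in suc k , cong suc sk≡i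
  select-onto {suc N} P (suc i) Pi | false = let k , sk≡i = select-onto (P ∘ suc) i Pi in k , cong suc sk≡i
  select-onto {suc N} P zero    Pi | false with () ← trans (sym eq) Pi

  count-size : ∀ {N} (P : Fin N → Bool) → HasSize _≡_ (λ i → P i ≡ true) (count P)
  count-size P = record
    { elt      = select P
    ; elt-in   = select-true P
    ; elt-inj  = select-injective P
    ; elt-onto = select-onto P
    }

  count≤1 : ∀ {N} (P : Fin N → Bool) → (∀ i j → P i ≡ true → P j ≡ true → i ≡ j) → count P ≤ 1
  count≤1 P unique = injective⇒≤ {f = λ _ → zero} λ {k} {k′} _ →
    select-injective P k k′ (unique _ _ (select-true P k) (select-true P k′))

  ∧-elimˡ : ∀ {a b} → a ∧ b ≡ true → a ≡ true
  ∧-elimˡ {true} _ = refl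

  ∧-elimʳ : ∀ {a b} → a ∧ b ≡ true → b ≡ true
  ∧-elimʳ {true} b≡true = b≡true

  not-either : ∀ {a b c} → (a ≡ true → c ≡ true) → (b ≡ true → c ≡ true) →
    not c ≡ true → not a ∧ not b ≡ true
  not-either {false} {false} _   _   _  = refl
  not-either {true}          a⇒c _   ¬c with () ← trans (cong not (sym (a⇒c refl))) ¬c
  not-either {false} {true}  _   b⇒c ¬c with () ← trans (cong not (sym (b⇒c refl))) ¬c

  dec-sound : ∀ {A : Set} (a? : Dec A) → does a? ≡ true → A
  dec-sound (yes a) _ = a

  count≤[_] : ∀ {N} {P : Fin N → Bool} b → (∀ i j → P i ≡ true → P j ≡ true → i ≡ j) →
    (∀ i → P i ≡ true → b ≡ true) → count P ≤ [ b ]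
  count≤[_] {P = P} true  unique P⇒b = count≤1 P unique
  count≤[_] {N} {P} false unique P⇒b = ≤-trans (count-mono P⇒b) (≤-reflexive (count-false N))

  module _ {A : Set} {_≈_ : A → A → Set} where

    size-≤ : ∀ {Q : A → Set} {k l} → IsEquivalence _≈_ → HasSize _≈_ Q l →
      (f : Fin k → A) → (∀ i → Q (f i)) → (∀ i j → f i ≈ f j → i ≡ j) → k ≤ l
    size-≤ isEq S f Qf f-inj = injective⇒≤ {f = index} λ {i} {j} eq → f-inj i j
      (≈-trans (≈-sym (proj₂ (find i))) (subst (λ t → elt t ≈ f j) (sym eq) (proj₂ (find j))))
      where
      open HasSize S
      open IsEquivalence isEq renaming (sym to ≈-sym; trans to ≈-trans)
      find : ∀ i → ∃ λ t → elt t ≈ f i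
      find i = elt-onto (f i) (Qf i)
      index : _ → _
      index i = proj₁ (find i)

    size-cong : ∀ {P Q : A → Set} {k} → (∀ a → P a → Q a) → (∀ a → Q a → P a) →
      HasSize _≈_ P k → HasSize _≈_ Q k
    size-cong P⇒Q Q⇒P S = record
      { elt = elt ; elt-in = P⇒Q _ ∘ elt-in ; elt-inj = elt-inj ; elt-onto = λ a → elt-onto a ∘ Q⇒P a }
      where open HasSize S

    size-filter : ∀ {P : A → Set} {k} (S : HasSize _≈_ P k) (b : A → Bool) →
      (∀ {a a′} → a ≈ a′ → b a ≡ b a′) →
      HasSize _≈_ (λ a → P a × b a ≡ true) (count (b ∘ HasSize.elt S))
    size-filter {P} S b b-resp = record
      { elt      = elt ∘ select B
      ; elt-in   = λ k → elt-in (select B k) , select-true B k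
      ; elt-inj  = λ k k′ eq → select-injective B k k′ (elt-inj _ _ eq)
      ; elt-onto = onto
      }
      where
      open HasSize S
      B = b ∘ elt
      onto : ∀ a → P a × b a ≡ true → ∃ λ k → elt (select B k) ≈ a
      onto a (Pa , ba) with i , eltᵢ≈a ← elt-onto a Pa
                      with k , refl ← select-onto B i (trans (b-resp eltᵢ≈a) ba) = k , eltᵢ≈a

  averaging : ∀ {N} (G : Fin N → Bool) (a : Fin N → ℕ) (x : ℕ) → (∃ λ m → G m ≡ true) →
    count G * x ≤ sum (λ m → [ G m ] * a m) → ∃ λ m → G m ≡ true × x ≤ a m
  averaging G a x (m₀ , Gm₀) avg
    with any? (λ m → (G m Data.Bool.≟ true) ×-dec (x ≤? a m))
  ... | yes found = found
  ... | no none = ⊥-elim (<⇒≱ (count-pos G m₀ Gm₀) count≤0)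
    where
    open ≤-Reasoning
    below : ∀ m → [ G m ] * suc (a m) ≤ [ G m ] * x
    below m with G m in Gm
    ... | false = z≤n
    ... | true  = +-monoˡ-≤ 0 (≰⇒> λ x≤a → none (m , Gm , x≤a))
    count≤0 : count G ≤ 0
    count≤0 = +-cancelʳ-≤ (sum (λ m → [ G m ] * a m)) (count G) 0 (begin
      count G + sum (λ m → [ G m ] * a m)   ≡⟨ ∑-distrib-+ ([_] ∘ G) (λ m → [ G m ] * a m) ⟨
      sum (λ m → [ G m ] + [ G m ] * a m)   ≡⟨ sum-cong-≗ (λ m → *-suc [ G m ] (a m)) ⟨
      sum (λ m → [ G m ] * suc (a m))       ≤⟨ sum-mono-≤ below ⟩
      sum (λ m → [ G m ] * x)               ≡⟨ *-distribʳ-sum x ([_] ∘ G) ⟨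
      count G * x                           ≤⟨ avg ⟩
      sum (λ m → [ G m ] * a m)             ∎)

module Enumeration where

  open import Data.Nat as ℕ using (ℕ; _^_)
  open import Data.Nat.Properties using (1+n≰n)
  open import Data.Fin using (Fin; zero; suc; punchOut)
  open import Data.Fin.Properties using (any?; all?)
  open import Data.Empty using (⊥-elim)
  import Data.Fin.Properties as Fin
  open import Data.Vec using (Vec)
  open import Data.Vec.Recursive using (lift↔; Fin[m^n]↔Fin[m]^n)
  open import Data.Vec.Recursive.Properties using (↔Vec)
  open import Data.Product using (∃; _,_)
  open import Data.Unit using (⊤; tt)
  open import Function using (_∘_)
  open import Function.Bundles using (_↔_; Inverse)
  open import Function.Properties.Inverse using (↔-trans)
  open import Relation.Nullary using (Dec; map′; yes; no)
  open import Relation.Unary using (Decidable)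
  open import Relation.Binary.Definitions using (DecidableEquality)
  open import Relation.Binary.PropositionalEquality

  vec↔ : ∀ {k} {A : Set} → Fin k ↔ A → ∀ n → Fin (k ^ n) ↔ Vec A n
  vec↔ {k} e n = ↔-trans (Fin[m^n]↔Fin[m]^n k n) (↔-trans (lift↔ n e) (↔Vec n))

  Fin-injective⇒surjective : ∀ {N} (f : Fin N → Fin N) → (∀ {i j} → f i ≡ f j → i ≡ j) →
    ∀ j → ∃ λ i → f i ≡ j
  Fin-injective⇒surjective {ℕ.zero}  f f-inj ()
  Fin-injective⇒surjective {ℕ.suc N} f f-inj j with any? (λ i → f i Fin.≟ j)
  ... | yes hit  = hit
  ... | no  miss = ⊥-elim (1+n≰n (Fin.injective⇒≤ {f = avoid-j} avoid-j-injective))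
    where
    avoid-j : Fin (ℕ.suc N) → Fin N
    avoid-j i = punchOut {i = j} λ j≡fi → miss (i , sym j≡fi)
    avoid-j-injective : ∀ {a b} → avoid-j a ≡ avoid-j b → a ≡ b
    avoid-j-injective eq = f-inj (Fin.punchOut-injective {i = j} _ _ eq)

  module _ {k} {A : Set} (e : Fin k ↔ A) where
    open Inverse e

    from-injective : ∀ {a b} → from a ≡ from b → a ≡ b
    from-injective {a} {b} eq = trans (sym (strictlyInverseˡ a)) (trans (cong to eq) (strictlyInverseˡ b))

    to-injective : ∀ {i j} → to i ≡ to j → i ≡ j
    to-injective {i} {j} eq = trans (sym (strictlyInverseʳ i)) (trans (cong from eq) (strictlyInverseʳ j))

    ∃? : {P : A → Set} → Decidable P → Dec (∃ P)
    ∃? {P} P? = map′ (λ (i , p) → to i , p)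
                     (λ (a , p) → from a , subst P (sym (strictlyInverseˡ a)) p)
                     (any? (P? ∘ to))

    ∀? : {P : A → Set} → Decidable P → Dec (∀ a → P a)
    ∀? {P} P? = map′ (λ all a → subst P (strictlyInverseˡ a) (all (from a)))
                     (λ all i → all (to i))
                     (all? (P? ∘ to))

    _≟_ : DecidableEquality A
    a ≟ b = map′ from-injective (cong from) (from a Fin.≟ from b)

    injective⇒surjective : (f : A → A) → (∀ {x y} → f x ≡ f y → x ≡ y) → ∀ y → ∃ λ x → f x ≡ y
    injective⇒surjective f f-inj y
      with i , hit ← Fin-injective⇒surjective (from ∘ f ∘ to) (to-injective ∘ f-inj ∘ from-injective) (from y)
      = to i , from-injective hit

    ↔-size : HasSize _≡_ (λ _ → ⊤) k
    ↔-size = record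
      { elt      = to
      ; elt-in   = λ _ → tt
      ; elt-inj  = λ _ _ → to-injective
      ; elt-onto = λ a _ → from a , strictlyInverseˡ a
      }

module LinearAlgebra (𝔽 : FiniteField) where

  open import Data.Nat as ℕ using (ℕ; zero; suc)
  open import Data.Nat.Properties using (<⇒≤; <⇒≱; ^-monoʳ-<; ≤-refl; m∸n+n≡m)
  open import Data.Fin using (Fin; zero; suc; _↑ʳ_)
  open import Data.Fin.Properties using (all?)
  open import Data.Vec using (Vec; []; _∷_; lookup; tabulate)
  import Data.Vec
  open import Data.Vec.Properties
  import Data.Vec.Functional as Vector
  open import Data.Product using (Σ; ∃; _×_; _,_; proj₁; proj₂)
  open import Data.Unit using (tt)
  open import Data.Empty using (⊥-elim)
  open import Function using (_∘_)
  open import Function.Bundles using (_↔_; Inverse)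
  open import Relation.Nullary using (Dec; yes; no; ¬_; map′; _→-dec_; ¬?)
  open import Relation.Nullary.Decidable using (decidable-stable)
  open import Relation.Binary.Definitions using (DecidableEquality)
  open import Relation.Binary.PropositionalEquality
  import Relation.Binary.PropositionalEquality as ≡
  open import Algebra.Structures using (IsCommutativeRing)
  open Counting using (size-≤)
  open Enumeration

  open FiniteField 𝔽
  open IsCommutativeRing isCommRing
    using (+-assoc; +-comm; +-identityˡ; +-identityʳ; -‿inverseˡ; -‿inverseʳ;
           *-assoc; *-comm; *-identityˡ; *-identityʳ; distribˡ; distribʳ; zeroˡ; zeroʳ)

  infixl 6 _+ᵥ_
  infixr 7 _·ᵥ_

  _+ᵥ_ : ∀ {n} → Pt 𝔽 n → Pt 𝔽 n → Pt 𝔽 n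
  _+ᵥ_ = _⊕_ 𝔽

  _·ᵥ_ : ∀ {n} → F → Pt 𝔽 n → Pt 𝔽 n
  _·ᵥ_ = _•_ 𝔽

  0ᵥ : ∀ {n} → Pt 𝔽 n
  0ᵥ = 𝟎 𝔽

  lc : ∀ {n r} → (Fin r → F) → (Fin r → Pt 𝔽 n) → Pt 𝔽 n
  lc = lincomb 𝔽

  +ᵥ-assoc : ∀ {n} (u v w : Pt 𝔽 n) → (u +ᵥ v) +ᵥ w ≡ u +ᵥ (v +ᵥ w)
  +ᵥ-assoc = zipWith-assoc +-assoc

  +ᵥ-comm : ∀ {n} (u v : Pt 𝔽 n) → u +ᵥ v ≡ v +ᵥ u
  +ᵥ-comm = zipWith-comm +-comm

  +ᵥ-identityˡ : ∀ {n} (v : Pt 𝔽 n) → 0ᵥ +ᵥ v ≡ v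
  +ᵥ-identityˡ = zipWith-identityˡ +-identityˡ

  +ᵥ-identityʳ : ∀ {n} (v : Pt 𝔽 n) → v +ᵥ 0ᵥ ≡ v
  +ᵥ-identityʳ = zipWith-identityʳ +-identityʳ

  +ᵥ-interchange : ∀ {n} (u v w z : Pt 𝔽 n) → (u +ᵥ v) +ᵥ (w +ᵥ z) ≡ (u +ᵥ w) +ᵥ (v +ᵥ z)
  +ᵥ-interchange u v w z = begin
    (u +ᵥ v) +ᵥ (w +ᵥ z)  ≡⟨ +ᵥ-assoc u v (w +ᵥ z) ⟩
    u +ᵥ (v +ᵥ (w +ᵥ z))  ≡⟨ cong (u +ᵥ_) (+ᵥ-assoc v w z) ⟨
    u +ᵥ ((v +ᵥ w) +ᵥ z)  ≡⟨ cong (λ t → u +ᵥ (t +ᵥ z)) (+ᵥ-comm v w) ⟩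
    u +ᵥ ((w +ᵥ v) +ᵥ z)  ≡⟨ cong (u +ᵥ_) (+ᵥ-assoc w v z) ⟩
    u +ᵥ (w +ᵥ (v +ᵥ z))  ≡⟨ +ᵥ-assoc u w (v +ᵥ z) ⟨
    (u +ᵥ w) +ᵥ (v +ᵥ z)  ∎
    where open ≡-Reasoning

  ·ᵥ-distribˡ : ∀ {n} a (u v : Pt 𝔽 n) → a ·ᵥ (u +ᵥ v) ≡ a ·ᵥ u +ᵥ a ·ᵥ v
  ·ᵥ-distribˡ a []      []      = refl
  ·ᵥ-distribˡ a (b ∷ u) (c ∷ v) = cong₂ _∷_ (distribˡ a b c) (·ᵥ-distribˡ a u v)

  ·ᵥ-distribʳ : ∀ {n} a b (v : Pt 𝔽 n) → (a + b) ·ᵥ v ≡ a ·ᵥ v +ᵥ b ·ᵥ v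
  ·ᵥ-distribʳ a b []      = refl
  ·ᵥ-distribʳ a b (c ∷ v) = cong₂ _∷_ (distribʳ c a b) (·ᵥ-distribʳ a b v)

  ·ᵥ-assoc : ∀ {n} a b (v : Pt 𝔽 n) → (a * b) ·ᵥ v ≡ a ·ᵥ b ·ᵥ v
  ·ᵥ-assoc a b []      = refl
  ·ᵥ-assoc a b (c ∷ v) = cong₂ _∷_ (*-assoc a b c) (·ᵥ-assoc a b v)

  ·ᵥ-zeroˡ : ∀ {n} (v : Pt 𝔽 n) → 0# ·ᵥ v ≡ 0ᵥ
  ·ᵥ-zeroˡ []      = refl
  ·ᵥ-zeroˡ (c ∷ v) = cong₂ _∷_ (zeroˡ c) (·ᵥ-zeroˡ v)

  ·ᵥ-zeroʳ : ∀ {n} a → a ·ᵥ 0ᵥ {n} ≡ 0ᵥ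
  ·ᵥ-zeroʳ {zero}  a = refl
  ·ᵥ-zeroʳ {suc n} a = cong₂ _∷_ (zeroʳ a) (·ᵥ-zeroʳ a)

  ·ᵥ-identityˡ : ∀ {n} (v : Pt 𝔽 n) → 1# ·ᵥ v ≡ v
  ·ᵥ-identityˡ []      = refl
  ·ᵥ-identityˡ (c ∷ v) = cong₂ _∷_ (*-identityˡ c) (·ᵥ-identityˡ v)

  lc-cong : ∀ {n r} {c d : Fin r → F} (v : Fin r → Pt 𝔽 n) → (∀ i → c i ≡ d i) → lc c v ≡ lc d v
  lc-cong {r = zero}  v c≗d = refl
  lc-cong {r = suc r} v c≗d = cong₂ _+ᵥ_ (cong (_·ᵥ v zero) (c≗d zero)) (lc-cong (v ∘ suc) (c≗d ∘ suc))

  lc-congᵛ : ∀ {n r} (c : Fin r → F) {v w : Fin r → Pt 𝔽 n} → (∀ i → v i ≡ w i) → lc c v ≡ lc c w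
  lc-congᵛ {r = zero}  c v≗w = refl
  lc-congᵛ {r = suc r} c v≗w = cong₂ _+ᵥ_ (cong (c zero ·ᵥ_) (v≗w zero)) (lc-congᵛ (c ∘ suc) (v≗w ∘ suc))

  lc-+ : ∀ {n r} (c d : Fin r → F) (v : Fin r → Pt 𝔽 n) → lc (λ i → c i + d i) v ≡ lc c v +ᵥ lc d v
  lc-+ {r = zero}  c d v = sym (+ᵥ-identityˡ 0ᵥ)
  lc-+ {r = suc r} c d v = trans
    (cong₂ _+ᵥ_ (·ᵥ-distribʳ (c zero) (d zero) (v zero)) (lc-+ (c ∘ suc) (d ∘ suc) (v ∘ suc)))
    (+ᵥ-interchange _ _ _ _)

  lc-* : ∀ {n r} a (c : Fin r → F) (v : Fin r → Pt 𝔽 n) → lc (λ i → a * c i) v ≡ a ·ᵥ lc c v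
  lc-* {r = zero}  a c v = sym (·ᵥ-zeroʳ a)
  lc-* {r = suc r} a c v = trans
    (cong₂ _+ᵥ_ (·ᵥ-assoc a (c zero) (v zero)) (lc-* a (c ∘ suc) (v ∘ suc)))
    (sym (·ᵥ-distribˡ a _ _))

  lc-zero : ∀ {n r} (v : Fin r → Pt 𝔽 n) → lc (λ _ → 0#) v ≡ 0ᵥ
  lc-zero {r = zero}  v = refl
  lc-zero {r = suc r} v = trans (cong₂ _+ᵥ_ (·ᵥ-zeroˡ (v zero)) (lc-zero (v ∘ suc))) (+ᵥ-identityˡ 0ᵥ)

  lc-linear : ∀ {n m r} (f : Pt 𝔽 n → Pt 𝔽 m) →
    (∀ x y → f (x +ᵥ y) ≡ f x +ᵥ f y) → (∀ a x → f (a ·ᵥ x) ≡ a ·ᵥ f x) →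
    (c : Fin r → F) (v : Fin r → Pt 𝔽 n) → f (lc c v) ≡ lc c (f ∘ v)
  lc-linear {r = zero} f f-+ f-· c v = begin
    f 0ᵥ             ≡⟨ cong f (·ᵥ-zeroˡ 0ᵥ) ⟨
    f (0# ·ᵥ 0ᵥ)     ≡⟨ f-· 0# 0ᵥ ⟩
    0# ·ᵥ f 0ᵥ       ≡⟨ ·ᵥ-zeroˡ (f 0ᵥ) ⟩
    0ᵥ               ∎
    where open ≡-Reasoning
  lc-linear {r = suc r} f f-+ f-· c v =
    trans (f-+ _ _) (cong₂ _+ᵥ_ (f-· (c zero) (v zero)) (lc-linear f f-+ f-· (c ∘ suc) (v ∘ suc)))

  lc-injective : ∀ {n r} (v : Fin r → Pt 𝔽 n) → LinIndep 𝔽 v →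
    ∀ c d → lc c v ≡ lc d v → ∀ i → c i ≡ d i
  lc-injective v indep c d eq i = difference-zero (indep (λ j → c j + (- d j)) c-d≡0 i)
    where
    open ≡-Reasoning
    difference-zero : ∀ {x y} → x + (- y) ≡ 0# → x ≡ y
    difference-zero {x} {y} x-y≡0 = begin
      x                ≡⟨ +-identityʳ x ⟨
      x + 0#           ≡⟨ cong (x +_) (-‿inverseˡ y) ⟨
      x + ((- y) + y)    ≡⟨ +-assoc x (- y) y ⟨
      (x + (- y)) + y    ≡⟨ cong (_+ y) x-y≡0 ⟩
      0# + y           ≡⟨ +-identityˡ y ⟩
      y                ∎
    c-d≡0 : lc (λ j → c j + (- d j)) v ≡ 0ᵥ
    c-d≡0 = begin
      lc (λ j → c j + (- d j)) v      ≡⟨ lc-+ c (λ j → - d j) v ⟩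
      lc c v +ᵥ lc (λ j → - d j) v  ≡⟨ cong (_+ᵥ _) eq ⟩
      lc d v +ᵥ lc (λ j → - d j) v  ≡⟨ lc-+ d (λ j → - d j) v ⟨
      lc (λ j → d j + (- d j)) v      ≡⟨ lc-cong v (λ j → -‿inverseʳ (d j)) ⟩
      lc (λ _ → 0#) v               ≡⟨ lc-zero v ⟩
      0ᵥ                            ∎

  Mat : ℕ → Set
  Mat n = Vec (Pt 𝔽 n) n

  ⟦_⟧ : ∀ {n} → Mat n → Pt 𝔽 n → Pt 𝔽 n
  ⟦ M ⟧ x = lc (lookup x) (lookup M)

  ⟦⟧-+ : ∀ {n} (M : Mat n) x y → ⟦ M ⟧ (x +ᵥ y) ≡ ⟦ M ⟧ x +ᵥ ⟦ M ⟧ y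
  ⟦⟧-+ M x y = trans (lc-cong (lookup M) λ i → lookup-zipWith _+_ i x y) (lc-+ (lookup x) (lookup y) (lookup M))

  ⟦⟧-· : ∀ {n} (M : Mat n) a x → ⟦ M ⟧ (a ·ᵥ x) ≡ a ·ᵥ ⟦ M ⟧ x
  ⟦⟧-· M a x = trans (lc-cong (lookup M) λ i → lookup-map i (a *_) x) (lc-* a (lookup x) (lookup M))

  ⟦⟧-lc : ∀ {n r} (M : Mat n) (c : Fin r → F) (v : Fin r → Pt 𝔽 n) → ⟦ M ⟧ (lc c v) ≡ lc c (⟦ M ⟧ ∘ v)
  ⟦⟧-lc M = lc-linear ⟦ M ⟧ (⟦⟧-+ M) (⟦⟧-· M)

  ⟦⟧-zero : ∀ {n} (M : Mat n) → ⟦ M ⟧ 0ᵥ ≡ 0ᵥ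
  ⟦⟧-zero M = ⟦⟧-lc {r = 0} M (λ ()) (λ ())

  ⟦⟧-tabulate : ∀ {n} (M : Mat n) (c : Fin n → F) → ⟦ M ⟧ (tabulate c) ≡ lc c (lookup M)
  ⟦⟧-tabulate M c = lc-cong (lookup M) (lookup∘tabulate c)

  e : ∀ {n} → Fin n → Pt 𝔽 n
  e {suc n} zero    = 1# ∷ 0ᵥ
  e {suc n} (suc t) = 0# ∷ e t

  lc-0∷ : ∀ {n r} (c : Fin r → F) (w : Fin r → Pt 𝔽 n) → lc c (λ t → 0# ∷ w t) ≡ 0# ∷ lc c w
  lc-0∷ {r = zero}  c w = refl
  lc-0∷ {r = suc r} c w = trans (cong (c zero ·ᵥ (0# ∷ w zero) +ᵥ_) (lc-0∷ (c ∘ suc) (w ∘ suc)))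
    (cong (_∷ c zero ·ᵥ w zero +ᵥ lc (c ∘ suc) (w ∘ suc)) (trans (+-identityʳ (c zero * 0#)) (zeroʳ (c zero))))

  lc-e : ∀ {n} (x : Pt 𝔽 n) → lc (lookup x) e ≡ x
  lc-e []      = refl
  lc-e (a ∷ x) = trans (cong (a ·ᵥ e zero +ᵥ_) (lc-0∷ (lookup x) e))
    (cong₂ _∷_ (trans (+-identityʳ (a * 1#)) (*-identityʳ a))
               (trans (cong (_+ᵥ lc (lookup x) e) (·ᵥ-zeroʳ a)) (trans (+ᵥ-identityˡ _) (lc-e x))))

  lc-lookup-e : ∀ {n m} (vs : Vec (Pt 𝔽 m) n) t → lc (lookup (e t)) (lookup vs) ≡ lookup vs t
  lc-lookup-e (v ∷ vs) zero    = trans (cong₂ _+ᵥ_ (·ᵥ-identityˡ v) rest≡0) (+ᵥ-identityʳ v)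
    where
    rest≡0 : lc (lookup 0ᵥ) (lookup vs) ≡ 0ᵥ
    rest≡0 = trans (lc-cong (lookup vs) λ i → lookup-replicate i 0#) (lc-zero (lookup vs))
  lc-lookup-e (v ∷ vs) (suc t) = trans (cong₂ _+ᵥ_ (·ᵥ-zeroˡ v) (lc-lookup-e vs t)) (+ᵥ-identityˡ _)

  ⟦⟧-e : ∀ {n} (M : Mat n) t → ⟦ M ⟧ (e t) ≡ lookup M t
  ⟦⟧-e = lc-lookup-e

  ⟦⟧-ext : ∀ {n} {M N : Mat n} → (∀ x → ⟦ M ⟧ x ≡ ⟦ N ⟧ x) → M ≡ N
  ⟦⟧-ext {M = M} {N} M≗N = trans (sym (tabulate∘lookup M)) (trans
    (tabulate-cong λ t → trans (sym (⟦⟧-e M t)) (trans (M≗N (e t)) (⟦⟧-e N t)))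
    (tabulate∘lookup N))

  I : ∀ {n} → Mat n
  I = tabulate e

  ⟦I⟧ : ∀ {n} (x : Pt 𝔽 n) → ⟦ I ⟧ x ≡ x
  ⟦I⟧ x = trans (lc-congᵛ (lookup x) (lookup∘tabulate e)) (lc-e x)

  infixr 9 _∙_

  _∙_ : ∀ {n} → Mat n → Mat n → Mat n
  M ∙ N = Data.Vec.map ⟦ M ⟧ N

  ⟦∙⟧ : ∀ {n} (M N : Mat n) x → ⟦ M ∙ N ⟧ x ≡ ⟦ M ⟧ (⟦ N ⟧ x)
  ⟦∙⟧ M N x = trans (lc-congᵛ (lookup x) λ t → lookup-map t ⟦ M ⟧ N) (sym (⟦⟧-lc M (lookup x) (lookup N)))

  Pt↔ : ∀ n → Fin (q ℕ.^ n) ↔ Pt 𝔽 n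
  Pt↔ = vec↔ enum

  lookup-ext : ∀ {A : Set} {n} {xs ys : Vec A n} → (∀ i → lookup xs i ≡ lookup ys i) → xs ≡ ys
  lookup-ext {xs = xs} {ys} xs≗ys =
    trans (sym (tabulate∘lookup xs)) (trans (tabulate-cong xs≗ys) (tabulate∘lookup ys))

  record GL {n} (M : Mat n) : Set where
    constructor mkGL
    field columns-independent : LinIndep 𝔽 (lookup M)

  GL-intro : ∀ {n} {M : Mat n} → (∀ x → ⟦ M ⟧ x ≡ 0ᵥ → x ≡ 0ᵥ) → GL M
  GL-intro {M = M} trivial-kernel = mkGL λ c c·M≡0 i → begin
    c i                      ≡⟨ lookup∘tabulate c i ⟨
    lookup (tabulate c) i    ≡⟨ cong (λ x → lookup x i) (trivial-kernel (tabulate c) (trans (⟦⟧-tabulate M c) c·M≡0)) ⟩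
    lookup 0ᵥ i              ≡⟨ lookup-replicate i 0# ⟩
    0#                       ∎
    where open ≡-Reasoning

  ⟦⟧-injective : ∀ {n} {M : Mat n} → GL M → ∀ {x y} → ⟦ M ⟧ x ≡ ⟦ M ⟧ y → x ≡ y
  ⟦⟧-injective {M = M} (mkGL indep) {x} {y} eq = lookup-ext (lc-injective (lookup M) indep (lookup x) (lookup y) eq)

  ⟦⟧-surjective : ∀ {n} {M : Mat n} → GL M → ∀ y → ∃ λ x → ⟦ M ⟧ x ≡ y
  ⟦⟧-surjective {n} {M} M-inv = injective⇒surjective (Pt↔ n) ⟦ M ⟧ (⟦⟧-injective M-inv)

  GL-I : ∀ {n} → GL (I {n})
  GL-I = GL-intro λ x Ix≡0 → trans (sym (⟦I⟧ x)) Ix≡0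

  GL-∙ : ∀ {n} {M N : Mat n} → GL M → GL N → GL (M ∙ N)
  GL-∙ {M = M} {N} M-inv N-inv = GL-intro λ x MNx≡0 → ⟦⟧-injective N-inv (trans
    (⟦⟧-injective M-inv (trans (sym (⟦∙⟧ M N x)) (trans MNx≡0 (sym (⟦⟧-zero M)))))
    (sym (⟦⟧-zero N)))

  ∙-cancelˡ : ∀ {n} {P M N : Mat n} → GL P → P ∙ M ≡ P ∙ N → M ≡ N
  ∙-cancelˡ {P = P} {M} {N} P-inv PM≡PN = ⟦⟧-ext λ x → ⟦⟧-injective P-inv
    (trans (sym (⟦∙⟧ P M x)) (trans (cong (λ Q → ⟦ Q ⟧ x) PM≡PN) (⟦∙⟧ P N x)))

  GL-inverse : ∀ {n} {M : Mat n} → GL M → Σ (Mat n) λ N → GL N × (∀ x → ⟦ N ⟧ (⟦ M ⟧ x) ≡ x)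
  GL-inverse {n} {M} M-inv = N , GL-intro N-kernel , λ x → ⟦⟧-injective M-inv (right-inverse (⟦ M ⟧ x))
    where
    N : Mat n
    N = tabulate λ t → proj₁ (⟦⟧-surjective M-inv (e t))
    right-inverse : ∀ y → ⟦ M ⟧ (⟦ N ⟧ y) ≡ y
    right-inverse y = begin
      ⟦ M ⟧ (⟦ N ⟧ y)                    ≡⟨ ⟦⟧-lc M (lookup y) (lookup N) ⟩
      lc (lookup y) (⟦ M ⟧ ∘ lookup N)   ≡⟨ lc-congᵛ (lookup y) (λ t → trans (cong ⟦ M ⟧ (lookup∘tabulate _ t))
                                                                    (proj₂ (⟦⟧-surjective M-inv (e t)))) ⟩
      lc (lookup y) e                    ≡⟨ lc-e y ⟩
      y                                  ∎
      where open ≡-Reasoning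
    N-kernel : ∀ x → ⟦ N ⟧ x ≡ 0ᵥ → x ≡ 0ᵥ
    N-kernel x Nx≡0 = trans (sym (right-inverse x)) (trans (cong ⟦ M ⟧ Nx≡0) (⟦⟧-zero M))

  _≟ᶠ_ : DecidableEquality F
  _≟ᶠ_ = _≟_ enum

  _≟ᵥ_ : ∀ {n} → DecidableEquality (Pt 𝔽 n)
  _≟ᵥ_ {n} = _≟_ (Pt↔ n)

  LinIndep? : ∀ {n r} (v : Fin r → Pt 𝔽 n) → Dec (LinIndep 𝔽 v)
  LinIndep? {r = r} v = map′
    (λ indep c c·v≡0 i → trans (sym (lookup∘tabulate c i))
                          (indep (tabulate c) (trans (lc-cong v (lookup∘tabulate c)) c·v≡0) i))
    (λ indep c → indep (lookup c))
    (∀? (vec↔ enum r) λ c → (lc (lookup c) v ≟ᵥ 0ᵥ) →-dec all? (λ i → lookup c i ≟ᶠ 0#))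

  GL? : ∀ {n} (M : Mat n) → Dec (GL M)
  GL? M = map′ mkGL GL.columns-independent (LinIndep? (lookup M))

  1<q : 1 ℕ.< q
  1<q = distinct⇒1< (from 0#) (from 1#) (0≢1 ∘ from-injective enum)
    where
    open Inverse enum
    distinct⇒1< : ∀ {N} (a b : Fin N) → a ≢ b → 1 ℕ.< N
    distinct⇒1< {suc zero}    zero zero a≢b = ⊥-elim (a≢b refl)
    distinct⇒1< {suc (suc N)} _    _    _   = ℕ.s≤s (ℕ.s≤s ℕ.z≤n)

  in-span? : ∀ {n m} (B : Fin m → Pt 𝔽 n) w → Dec (∃ λ c → lc (lookup c) B ≡ w)
  in-span? {m = m} B w = ∃? (vec↔ enum m) λ c → lc (lookup c) B ≟ᵥ w

  -- The span of m vectors has at most q^m < q^n points.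
  outside-span : ∀ {n m} (B : Fin m → Pt 𝔽 n) → m ℕ.< n → ∃ λ w → ¬ (∃ λ c → lc c B ≡ w)
  outside-span {n} {m} B m<n with ∃? (Pt↔ n) (¬? ∘ in-span? B)
  ... | yes (w , unreachable) =
    w , λ (c , c·B≡w) → unreachable (tabulate c , trans (lc-cong B (lookup∘tabulate c)) c·B≡w)
  ... | no everything-reachable = ⊥-elim (<⇒≱ (^-monoʳ-< q 1<q m<n) q^n≤q^m)
    where
    open Inverse (Pt↔ n)
    coefficients : ∀ w → ∃ λ c → lc (lookup c) B ≡ w
    coefficients w = decidable-stable (in-span? B w) λ unreachable → everything-reachable (w , unreachable)
    q^n≤q^m : q ℕ.^ n ℕ.≤ q ℕ.^ m
    q^n≤q^m = size-≤ ≡.isEquivalence (↔-size (vec↔ enum m)) (proj₁ ∘ coefficients ∘ to) (λ _ → tt)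
      λ i j eq → to-injective (Pt↔ n) (trans (sym (proj₂ (coefficients (to i))))
                   (trans (cong (λ c → lc (lookup c) B) eq) (proj₂ (coefficients (to j)))))

  cons-independent : ∀ {n m} (B : Fin m → Pt 𝔽 n) (w : Pt 𝔽 n) → LinIndep 𝔽 B →
    ¬ (∃ λ c → lc c B ≡ w) → LinIndep 𝔽 (w Vector.∷ B)
  cons-independent B w B-indep w∉span c c·wB≡0 with c zero ≟ᶠ 0#
  ... | yes c₀≡0 = λ where
      zero    → c₀≡0
      (suc i) → B-indep (c ∘ suc) (trans (sym (trans (cong (_+ᵥ _) (trans (cong (_·ᵥ w) c₀≡0) (·ᵥ-zeroˡ w)))
                                                     (+ᵥ-identityˡ _))) c·wB≡0) i
  ... | no c₀≢0 = ⊥-elim (w∉span ((λ i → (- d) * c (suc i)) , sym w≡comb))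
    where
    open ≡-Reasoning
    d = proj₁ (inverse (c zero) c₀≢0)
    d·c₀≡1 : d * c zero ≡ 1#
    d·c₀≡1 = trans (*-comm d (c zero)) (proj₂ (inverse (c zero) c₀≢0))
    L = lc (c ∘ suc) B
    w+dL≡0 : w +ᵥ d ·ᵥ L ≡ 0ᵥ
    w+dL≡0 = begin
      w +ᵥ d ·ᵥ L                     ≡⟨ cong (_+ᵥ d ·ᵥ L) (·ᵥ-identityˡ w) ⟨
      1# ·ᵥ w +ᵥ d ·ᵥ L               ≡⟨ cong (λ a → a ·ᵥ w +ᵥ d ·ᵥ L) d·c₀≡1 ⟨
      (d * c zero) ·ᵥ w +ᵥ d ·ᵥ L     ≡⟨ cong (_+ᵥ d ·ᵥ L) (·ᵥ-assoc d (c zero) w) ⟩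
      d ·ᵥ c zero ·ᵥ w +ᵥ d ·ᵥ L      ≡⟨ ·ᵥ-distribˡ d _ _ ⟨
      d ·ᵥ (c zero ·ᵥ w +ᵥ L)         ≡⟨ cong (d ·ᵥ_) c·wB≡0 ⟩
      d ·ᵥ 0ᵥ                         ≡⟨ ·ᵥ-zeroʳ d ⟩
      0ᵥ                              ∎
    w≡comb : w ≡ lc (λ i → (- d) * c (suc i)) B
    w≡comb = begin
      w                               ≡⟨ +ᵥ-identityʳ w ⟨
      w +ᵥ 0ᵥ                         ≡⟨ cong (w +ᵥ_) (trans (cong (_·ᵥ L) (-‿inverseʳ d)) (·ᵥ-zeroˡ L)) ⟨
      w +ᵥ (d + (- d)) ·ᵥ L           ≡⟨ cong (w +ᵥ_) (·ᵥ-distribʳ d (- d) L) ⟩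
      w +ᵥ (d ·ᵥ L +ᵥ (- d) ·ᵥ L)     ≡⟨ +ᵥ-assoc w _ _ ⟨
      (w +ᵥ d ·ᵥ L) +ᵥ (- d) ·ᵥ L     ≡⟨ cong (_+ᵥ (- d) ·ᵥ L) w+dL≡0 ⟩
      0ᵥ +ᵥ (- d) ·ᵥ L                ≡⟨ +ᵥ-identityˡ _ ⟩
      (- d) ·ᵥ L                      ≡⟨ lc-* (- d) (c ∘ suc) B ⟨
      lc (λ i → (- d) * c (suc i)) B  ∎

  extend : ∀ {n r} k (v : Fin r → Pt 𝔽 n) → LinIndep 𝔽 v → k ℕ.+ r ℕ.≤ n →
    Σ (Fin (k ℕ.+ r) → Pt 𝔽 n) λ B → LinIndep 𝔽 B × (∀ i → B (k ↑ʳ i) ≡ v i)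
  extend zero    v v-indep _ = v , v-indep , λ _ → refl
  extend (suc k) v v-indep k+r<n
    with B , B-indep , B-v ← extend k v v-indep (<⇒≤ k+r<n)
    with w , w∉span ← outside-span B k+r<n
    = w Vector.∷ B , cons-independent B w B-indep w∉span , B-v

  frame : ∀ {r} k (v : Fin r → Pt 𝔽 (k ℕ.+ r)) → LinIndep 𝔽 v →
    Σ (Mat (k ℕ.+ r)) λ M → GL M × (∀ i → ⟦ M ⟧ (e (k ↑ʳ i)) ≡ v i)
  frame k v v-indep with B , B-indep , B-v ← extend k v v-indep ≤-refl =
    tabulate B ,
    mkGL (λ c c·B≡0 → B-indep c (trans (sym (lc-congᵛ c (lookup∘tabulate B))) c·B≡0)) ,
    λ i → trans (⟦⟧-e (tabulate B) (k ↑ʳ i)) (trans (lookup∘tabulate B (k ↑ʳ i)) (B-v i))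

  GL-transitive : ∀ {n r} → r ℕ.≤ n → (v w : Fin r → Pt 𝔽 n) → LinIndep 𝔽 v → LinIndep 𝔽 w →
    Σ (Mat n) λ P → GL P × (∀ i → ⟦ P ⟧ (w i) ≡ v i)
  GL-transitive {n} {r} r≤n = subst Transitive (m∸n+n≡m r≤n) (transitive-+ (n ℕ.∸ r))
    where
    Transitive : ℕ → Set
    Transitive m = (v w : Fin r → Pt 𝔽 m) → LinIndep 𝔽 v → LinIndep 𝔽 w →
      Σ (Mat m) λ P → GL P × (∀ i → ⟦ P ⟧ (w i) ≡ v i)
    transitive-+ : ∀ k → Transitive (k ℕ.+ r)
    transitive-+ k v w v-indep w-indep
      with Mv , Mv-inv , Mv-v ← frame k v v-indep
      with Mw , Mw-inv , Mw-w ← frame k w w-indep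
      with Nw , Nw-inv , Nw-Mw ← GL-inverse Mw-inv
      = Mv ∙ Nw , GL-∙ Mv-inv Nw-inv , λ i → begin
        ⟦ Mv ∙ Nw ⟧ (w i)                      ≡⟨ ⟦∙⟧ Mv Nw (w i) ⟩
        ⟦ Mv ⟧ (⟦ Nw ⟧ (w i))                  ≡⟨ cong (⟦ Mv ⟧ ∘ ⟦ Nw ⟧) (Mw-w i) ⟨
        ⟦ Mv ⟧ (⟦ Nw ⟧ (⟦ Mw ⟧ (e (k ↑ʳ i))))  ≡⟨ cong ⟦ Mv ⟧ (Nw-Mw (e (k ↑ʳ i))) ⟩
        ⟦ Mv ⟧ (e (k ↑ʳ i))                    ≡⟨ Mv-v i ⟩
        v i                                    ∎
      where open ≡-Reasoning

module Subspaces (𝔽 : FiniteField) where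

  open import Data.Nat using (ℕ; _≤_; _+_; _^_)
  open import Data.Fin using (Fin)
  open import Data.Bool using (Bool; true; false; _∨_)
  import Data.Bool as Bool
  open import Data.Product using (Σ; ∃; _×_; _,_; proj₁; proj₂)
  open import Data.Unit using (tt)
  open import Function using (_∘_; _⇔_; mk⇔; Equivalence)
  open import Function.Bundles using (Inverse)
  open import Relation.Nullary using (Dec; _→-dec_)
  open import Relation.Binary.PropositionalEquality
  open LinearAlgebra 𝔽
  open Enumeration using (∃?; ∀?)
  open Counting using (count; count-∨; count-false; size-≤; size-cong; size-filter)

  Spans : ∀ {n r} → Subset 𝔽 n → (Fin r → Pt 𝔽 n) → Set
  Spans S v = ∀ x → (S x ≡ true) ⇔ (∃ λ c → lc c v ≡ x)

  pull : ∀ {n} → Mat n → Subset 𝔽 n → Subset 𝔽 n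
  pull M S = S ∘ ⟦ M ⟧

  Spans-pull : ∀ {n r} {M : Mat n} {S : Subset 𝔽 n} {u v : Fin r → Pt 𝔽 n} → GL M →
    (∀ i → ⟦ M ⟧ (u i) ≡ v i) → Spans S v → Spans (pull M S) u
  Spans-pull {M = M} {S} {u} {v} M-inv Mu≗v v-spans x = mk⇔
    (λ Mx∈S → let c , c·v≡Mx = to (v-spans (⟦ M ⟧ x)) Mx∈S
              in c , ⟦⟧-injective M-inv (trans (M-lc c) c·v≡Mx))
    (λ (c , c·u≡x) → from (v-spans (⟦ M ⟧ x)) (c , trans (sym (M-lc c)) (cong ⟦ M ⟧ c·u≡x)))
    where
    open Equivalence
    M-lc : ∀ c → ⟦ M ⟧ (lc c u) ≡ lc c v
    M-lc c = trans (⟦⟧-lc M c u) (lc-congᵛ c Mu≗v)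

  Spans-unique : ∀ {n r} {S T : Subset 𝔽 n} {v : Fin r → Pt 𝔽 n} → Spans S v → Spans T v → S ≗ T
  Spans-unique {S = S} {T} S-span T-span x = Bool-⇔ (S x) (T x)
    (from (T-span x) ∘ to (S-span x)) (from (S-span x) ∘ to (T-span x))
    where
    open Equivalence
    Bool-⇔ : ∀ a b → (a ≡ true → b ≡ true) → (b ≡ true → a ≡ true) → a ≡ b
    Bool-⇔ true  b a⇒b b⇒a = sym (a⇒b refl)
    Bool-⇔ false true  a⇒b b⇒a = b⇒a refl
    Bool-⇔ false false a⇒b b⇒a = refl

  IsGr-pull : ∀ {n r} {M : Mat n} {S : Subset 𝔽 n} → GL M → IsGr 𝔽 n r S → IsGr 𝔽 n r (pull M S)
  IsGr-pull {M = M} M-inv (v , v-indep , v-spans) = u , u-indep , Spans-pull M-inv Mu≗v v-spans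
    where
    u = λ i → proj₁ (⟦⟧-surjective M-inv (v i))
    Mu≗v = λ i → proj₂ (⟦⟧-surjective M-inv (v i))
    u-indep : LinIndep 𝔽 u
    u-indep c c·u≡0 = v-indep c (begin
      lc c v             ≡⟨ lc-congᵛ c Mu≗v ⟨
      lc c (⟦ M ⟧ ∘ u)   ≡⟨ ⟦⟧-lc M c u ⟨
      ⟦ M ⟧ (lc c u)     ≡⟨ cong ⟦ M ⟧ c·u≡0 ⟩
      ⟦ M ⟧ 0ᵥ           ≡⟨ ⟦⟧-zero M ⟩
      0ᵥ                 ∎)
      where open ≡-Reasoning

  pull-transitive : ∀ {n r} {S T : Subset 𝔽 n} → r ≤ n → IsGr 𝔽 n r S → IsGr 𝔽 n r T →
    Σ (Mat n) λ P → GL P × pull P S ≗ T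
  pull-transitive r≤n (v , v-indep , v-spans) (w , w-indep , w-spans)
    with P , P-inv , Pw≗v ← GL-transitive r≤n v w v-indep w-indep
    = P , P-inv , Spans-unique (Spans-pull P-inv Pw≗v v-spans) w-spans

  TranslateIn-pull : ∀ {n} {M : Mat n} {S K : Subset 𝔽 n} → GL M →
    TranslateIn 𝔽 S K → TranslateIn 𝔽 (pull M S) (pull M K)
  TranslateIn-pull {M = M} {S} {K} M-inv (x , x+S⊆K) with x′ , Mx′≡x ← ⟦⟧-surjective M-inv x =
    x′ , λ y My∈S → trans (cong K (trans (⟦⟧-+ M x′ y) (cong (_+ᵥ ⟦ M ⟧ y) Mx′≡x)))
                          (x+S⊆K (⟦ M ⟧ y) My∈S)

  TranslateIn-cong : ∀ {n} {S S′ K : Subset 𝔽 n} → S ≗ S′ → TranslateIn 𝔽 S K → TranslateIn 𝔽 S′ K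
  TranslateIn-cong S≗S′ (x , x+S⊆K) = x , λ y y∈S′ → x+S⊆K y (trans (S≗S′ y) y∈S′)

  TranslateIn-mono : ∀ {n} {S K K′ : Subset 𝔽 n} → (∀ x → K x ≡ true → K′ x ≡ true) →
    TranslateIn 𝔽 S K → TranslateIn 𝔽 S K′
  TranslateIn-mono K⊆K′ (x , x+S⊆K) = x , λ y y∈S → K⊆K′ _ (x+S⊆K y y∈S)

  TranslateIn? : ∀ {n} (S K : Subset 𝔽 n) → Dec (TranslateIn 𝔽 S K)
  TranslateIn? {n} S K =
    ∃? (Pt↔ n) λ x → ∀? (Pt↔ n) λ y → (S y Bool.≟ true) →-dec (K (x +ᵥ y) Bool.≟ true)

  _≗?_ : ∀ {n} (S T : Subset 𝔽 n) → Dec (S ≗ T)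
  _≗?_ {n} S T = ∀? (Pt↔ n) λ x → S x Bool.≟ T x

  size : ∀ {n} → Subset 𝔽 n → ℕ
  size {n} X = count (X ∘ Inverse.to (Pt↔ n))

  size-Card : ∀ {n} (X : Subset 𝔽 n) → Card 𝔽 X (size X)
  size-Card {n} X = size-cong (λ _ → proj₂) (λ _ → tt ,_) (size-filter (Enumeration.↔-size (Pt↔ n)) X (cong X))

  Card⇒size≤ : ∀ {n} {X : Subset 𝔽 n} {k} → Card 𝔽 X k → size X ≤ k
  Card⇒size≤ {X = X} X-card = size-≤ isEquivalence X-card elt elt-in elt-inj
    where open HasSize (size-Card X)

  size-pull : ∀ {n} {M : Mat n} (K : Subset 𝔽 n) → GL M → size (pull M K) ≤ size K
  size-pull {M = M} K M-inv = size-≤ isEquivalence (size-Card K) (⟦ M ⟧ ∘ elt) elt-in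
    λ i j eq → elt-inj i j (⟦⟧-injective M-inv eq)
    where open HasSize (size-Card (pull M K))

  size-∪ : ∀ {n} (X Y : Subset 𝔽 n) → size (λ x → X x ∨ Y x) ≤ size X + size Y
  size-∪ {n} X Y = count-∨ (X ∘ Inverse.to (Pt↔ n)) (Y ∘ Inverse.to (Pt↔ n))

  size-∅ : ∀ n → size {n} (λ _ → false) ≡ 0
  size-∅ n = count-false (q ^ n)
    where open FiniteField 𝔽 using (q)

-- moves j i m: the group element m ∈ G sends the point j to the point i.  Transitivity of the action
-- is used only through fibres-equal.
module TransitiveAveraging
  {N g : ℕ}
  (G : Fin N → Bool)
  (moves : Fin g → Fin g → Fin N → Bool)
  (covered : Fin g → Bool)
  (covered-by : Fin N → Fin g → Bool)
  (source : ∀ i m → G m ≡ true → ∃ λ j → moves j i m ≡ true)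
  (source-unique : ∀ {i m} j j′ → moves j i m ≡ true → moves j′ i m ≡ true → j ≡ j′)
  (fibres-equal : ∀ i j → Counting.count (moves j i) ≡ Counting.count (moves i i))
  (transport : ∀ {i j m} → covered j ≡ true → moves j i m ≡ true → G m ∧ covered-by m i ≡ true)
  where

  open import Data.Nat using (_*_; _≤_; z≤n)
  open import Data.Nat.Properties using (*-comm; *-assoc; *-monoʳ-≤; module ≤-Reasoning)
  open import Data.Bool using (false)
  import Data.Nat.Solver
  open import Data.Product using (_×_; _,_)
  open import Relation.Binary.PropositionalEquality using (refl; trans; cong)
  open import Function using (_∘_)
  open Counting

  hits : Fin N → Fin g → Bool
  hits m i = G m ∧ covered-by m i

  orbit-bound : ∀ i → count G ≤ g * count (moves i i)
  orbit-bound i = begin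
    count G                              ≤⟨ sum-mono-≤ G≤sources ⟩
    sum (λ m → count (λ j → moves j i m)) ≡⟨ ∑-comm (λ m j → [ moves j i m ]) ⟩
    sum (λ j → count (moves j i))        ≡⟨ sum-cong-≗ (λ j → fibres-equal i j) ⟩
    sum {g} (λ _ → count (moves i i))    ≡⟨ sum-const g (count (moves i i)) ⟩
    g * count (moves i i)                ∎
    where
    open ≤-Reasoning
    G≤sources : ∀ m → [ G m ] ≤ count (λ j → moves j i m)
    G≤sources m with G m in Gm
    ... | false = z≤n
    ... | true  = let j , j↦i = source i m Gm in count-pos (λ j → moves j i m) j j↦i

  cover-bound : ∀ i → count covered * count (moves i i) ≤ count (λ m → hits m i)
  cover-bound i = begin
    count covered * f
      ≡⟨ *-distribʳ-sum f ([_] ∘ covered) ⟩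
    sum (λ j → [ covered j ] * f)
      ≡⟨ sum-cong-≗ (λ j → cong ([ covered j ] *_) (fibres-equal i j)) ⟨
    sum (λ j → [ covered j ] * count (moves j i))
      ≡⟨ sum-cong-≗ (λ j → *-distribˡ-sum [ covered j ] ([_] ∘ moves j i)) ⟩
    sum (λ j → sum (λ m → [ covered j ] * [ moves j i m ]))
      ≡⟨ sum-cong-≗ (λ j → sum-cong-≗ λ m → [∧] (covered j) (moves j i m)) ⟨
    sum (λ j → sum (λ m → [ covered j ∧ moves j i m ]))
      ≡⟨ ∑-comm (λ j m → [ covered j ∧ moves j i m ]) ⟩
    sum (λ m → count (λ j → covered j ∧ moves j i m))
      ≤⟨ sum-mono-≤ at-most-one-source ⟩
    count (λ m → hits m i)
      ∎
    where
    open ≤-Reasoning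
    f = count (moves i i)
    at-most-one-source : ∀ m → count (λ j → covered j ∧ moves j i m) ≤ [ hits m i ]
    at-most-one-source m = count≤[ hits m i ]
      (λ j j′ p p′ → source-unique j j′ (∧-elimʳ p) (∧-elimʳ p′))
      (λ j p → transport (∧-elimˡ p) (∧-elimʳ p))

  point-bound : ∀ i → count covered * count G ≤ g * count (λ m → hits m i)
  point-bound i = begin
    c * count G                  ≤⟨ *-monoʳ-≤ c (orbit-bound i) ⟩
    c * (g * count (moves i i))  ≡⟨ *-assoc c g _ ⟨
    (c * g) * count (moves i i)  ≡⟨ cong (_* count (moves i i)) (*-comm c g) ⟩
    (g * c) * count (moves i i)  ≡⟨ *-assoc g c _ ⟩
    g * (c * count (moves i i))  ≤⟨ *-monoʳ-≤ g (cover-bound i) ⟩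
    g * count (λ m → hits m i)   ∎
    where
    open ≤-Reasoning
    c = count covered

  averaging-step : (∃ λ m → G m ≡ true) → (U : Fin g → Bool) →
    ∃ λ m → G m ≡ true × count U * count covered ≤ g * count (λ i → U i ∧ covered-by m i)
  averaging-step G-nonempty U = averaging G (λ m → g * newly-hit m) (count U * c) G-nonempty (begin
    count G * (count U * c)
      ≡⟨ *-rotate (count G) (count U) c ⟩
    count U * (c * count G)
      ≡⟨ *-distribʳ-sum (c * count G) ([_] ∘ U) ⟩
    sum (λ i → [ U i ] * (c * count G))
      ≤⟨ sum-mono-≤ (λ i → *-monoʳ-≤ [ U i ] (point-bound i)) ⟩
    sum (λ i → [ U i ] * (g * count (λ m → hits m i)))
      ≡⟨ sum-cong-≗ (λ i → distribute [ U i ] λ m → [ hits m i ]) ⟩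
    sum (λ i → sum (λ m → [ U i ] * (g * [ hits m i ])))
      ≡⟨ ∑-comm (λ i m → [ U i ] * (g * [ hits m i ])) ⟩
    sum (λ m → sum (λ i → [ U i ] * (g * [ hits m i ])))
      ≡⟨ sum-cong-≗ (λ m → sum-cong-≗ λ i → exchange (U i) (G m) (covered-by m i)) ⟩
    sum (λ m → sum (λ i → [ G m ] * (g * [ U i ∧ covered-by m i ])))
      ≡⟨ sum-cong-≗ (λ m → distribute [ G m ] λ i → [ U i ∧ covered-by m i ]) ⟨
    sum (λ m → [ G m ] * (g * newly-hit m))
      ∎)
    where
    open ≤-Reasoning
    open Data.Nat.Solver.+-*-Solver
    c = count covered
    newly-hit : Fin N → ℕ
    newly-hit m = count (λ i → U i ∧ covered-by m i)
    distribute : ∀ {K} a (h : Fin K → ℕ) → a * (g * sum h) ≡ sum (λ k → a * (g * h k))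
    distribute a h = trans (cong (a *_) (*-distribˡ-sum g h)) (*-distribˡ-sum a (λ k → g * h k))
    *-rotate : ∀ x u c → x * (u * c) ≡ u * (c * x)
    *-rotate = solve 3 (λ x u c → x :* (u :* c) := u :* (c :* x)) refl
    exchange : ∀ a b d → [ a ] * (g * [ b ∧ d ]) ≡ [ b ] * (g * [ a ∧ d ])
    exchange a b d rewrite [∧] a d | [∧] b d =
      solve 4 (λ a b d g → a :* (g :* (b :* d)) := b :* (g :* (a :* d))) refl [ a ] [ b ] [ d ] g

module Rationals where

  open import Data.Nat as ℕ using (ℕ; zero; suc)
  import Data.Nat.Properties as ℕ
  open import Data.Nat.Coprimality using (1-coprimeTo)
  import Data.Nat.Coprimality as Coprimality
  open import Data.Integer as ℤ using (+_)
  import Data.Integer.Properties as ℤ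
  open import Data.Rational as ℚ using (ℚ; mkℚ; 1ℚ; _+_; _*_; _-_; -_; _≤_)
  import Data.Rational.Properties as ℚ
  import Data.Rational.Unnormalised as ℚᵘ
  import Data.Rational.Unnormalised.Properties as ℚᵘ
  open import Data.Rational.Solver using (module +-*-Solver)
  open import Relation.Binary.PropositionalEquality
  open +-*-Solver

  -- ι is Defs' ℕ→ℚ.  Lemmas below take the naturals explicitly, as ι k does not determine k for the
  -- unifier (it unfolds into a gcd normalisation).
  ι : ℕ → ℚ
  ι k = + k ℚ./ 1

  private
    ι-mkℚ : ∀ k → ι k ≡ mkℚ (+ k) 0 (Coprimality.sym (1-coprimeTo k))
    ι-mkℚ k = ℚ.normalize-coprime _

  ι-+ : ∀ a b → ι (a ℕ.+ b) ≡ ι a + ι b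
  ι-+ a b = ℚ.toℚᵘ-injective (ℚᵘ.≃-trans unnormalised (ℚᵘ.≃-sym (ℚ.toℚᵘ-homo-+ (ι a) (ι b))))
    where
    unnormalised : ℚ.toℚᵘ (ι (a ℕ.+ b)) ℚᵘ.≃ (ℚ.toℚᵘ (ι a) ℚᵘ.+ ℚ.toℚᵘ (ι b))
    unnormalised rewrite ι-mkℚ (a ℕ.+ b) | ι-mkℚ a | ι-mkℚ b = ℚᵘ.*≡* (begin
      + (a ℕ.+ b) ℤ.* + 1                    ≡⟨ ℤ.*-identityʳ _ ⟩
      + (a ℕ.+ b)                            ≡⟨ ℤ.pos-+ a b ⟩
      + a ℤ.+ + b                            ≡⟨ cong₂ ℤ._+_ (ℤ.*-identityʳ (+ a)) (ℤ.*-identityʳ (+ b)) ⟨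
      + a ℤ.* + 1 ℤ.+ + b ℤ.* + 1            ≡⟨ ℤ.*-identityʳ _ ⟨
      (+ a ℤ.* + 1 ℤ.+ + b ℤ.* + 1) ℤ.* + 1  ∎)
      where open ≡-Reasoning

  ι-* : ∀ a b → ι (a ℕ.* b) ≡ ι a * ι b
  ι-* a b = ℚ.toℚᵘ-injective (ℚᵘ.≃-trans unnormalised (ℚᵘ.≃-sym (ℚ.toℚᵘ-homo-* (ι a) (ι b))))
    where
    unnormalised : ℚ.toℚᵘ (ι (a ℕ.* b)) ℚᵘ.≃ (ℚ.toℚᵘ (ι a) ℚᵘ.* ℚ.toℚᵘ (ι b))
    unnormalised rewrite ι-mkℚ (a ℕ.* b) | ι-mkℚ a | ι-mkℚ b = ℚᵘ.*≡* (begin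
      + (a ℕ.* b) ℤ.* + 1    ≡⟨ ℤ.*-identityʳ _ ⟩
      + (a ℕ.* b)            ≡⟨ ℤ.pos-* a b ⟩
      + a ℤ.* + b            ≡⟨ ℤ.*-identityʳ _ ⟨
      (+ a ℤ.* + b) ℤ.* + 1  ∎)
      where open ≡-Reasoning

  ι-mono-≤ : ∀ {a b} → a ℕ.≤ b → ι a ≤ ι b
  ι-mono-≤ {a} {b} a≤b rewrite ι-mkℚ a | ι-mkℚ b =
    ℚ.*≤* (subst₂ ℤ._≤_ (sym (ℤ.*-identityʳ (+ a))) (sym (ℤ.*-identityʳ (+ b))) (ℤ.+≤+ a≤b))

  ι-nonNeg : ∀ a → ℚ.NonNegative (ι a)
  ι-nonNeg a = ℚ.nonNegative (ι-mono-≤ {0} {a} ℕ.z≤n)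

  ι-pos : ∀ a → ℚ.Positive (ι (suc a))
  ι-pos a rewrite ι-mkℚ (suc a) = _

  +≤⇒≤- : ∀ {x y z : ℚ} → x + y ≤ z → x ≤ z - y
  +≤⇒≤- {x} {y} {z} x+y≤z = ℚ.≤-trans (ℚ.≤-reflexive (solve 2 (λ x y → x := (x :+ y) :- y) refl x y))
                                       (ℚ.+-monoˡ-≤ (- y) x+y≤z)

  decay : ∀ (ε : ℚ) (u u′ a g c : ℕ) → ε * ι g ≤ ι c →
    u′ ℕ.+ a ℕ.≤ u → u ℕ.* c ℕ.≤ g ℕ.* a → u ℕ.≤ g → ι u′ ≤ (1ℚ - ε) * ι u
  decay ε u u′ a zero c εg≤c u′+a≤u uc≤ga u≤0
    with refl ← ℕ.n≤0⇒n≡0 u≤0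
    with refl ← ℕ.n≤0⇒n≡0 (ℕ.m+n≤o⇒m≤o u′ u′+a≤u)
    = ℚ.≤-reflexive (sym (ℚ.*-zeroʳ (1ℚ - ε)))
  decay ε u u′ a g@(suc g-1) c εg≤c u′+a≤u uc≤ga _ =
    ℚ.*-cancelˡ-≤-pos (ι g) {{ι-pos g-1}} (begin
      G * U′                   ≤⟨ +≤⇒≤- (ℚ.≤-trans (ℚ.+-monoʳ-≤ (G * U′) uεg≤ga) gu′+ga≤gu) ⟩
      G * U - U * (ε * G)      ≡⟨ solve 3 (λ G U ε → G :* U :- U :* (ε :* G) := G :* ((con 1ℚ :- ε) :* U))
                                          refl G U ε ⟩
      G * ((1ℚ - ε) * U)       ∎)
    where
    open ℚ.≤-Reasoning
    G = ι g
    U = ι u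
    U′ = ι u′
    instance
      U-nonNeg : ℚ.NonNegative U
      U-nonNeg = ι-nonNeg u
      G-nonNeg : ℚ.NonNegative G
      G-nonNeg = ι-nonNeg g
    uεg≤ga : U * (ε * G) ≤ G * ι a
    uεg≤ga = ℚ.≤-trans (ℚ.*-monoˡ-≤-nonNeg U εg≤c) (subst₂ _≤_ (ι-* u c) (ι-* g a) (ι-mono-≤ uc≤ga))
    gu′+ga≤gu : G * U′ + G * ι a ≤ G * U
    gu′+ga≤gu = begin
      G * U′ + G * ι a     ≡⟨ ℚ.*-distribˡ-+ G U′ (ι a) ⟨
      G * (U′ + ι a)       ≡⟨ cong (G *_) (ι-+ u′ a) ⟨
      G * ι (u′ ℕ.+ a)     ≤⟨ ℚ.*-monoˡ-≤-nonNeg G (ι-mono-≤ u′+a≤u) ⟩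
      G * U                ∎

  decay-iterate : ∀ (ρ : ℚ) j (u u′ g : ℕ) → ℚ.NonNegative ρ →
    ι u ≤ (ρ ^ℚ j) * ι g → ι u′ ≤ ρ * ι u → ι u′ ≤ (ρ ^ℚ suc j) * ι g
  decay-iterate ρ j u u′ g ρ≥0 u≤ρʲg u′≤ρu = ℚ.≤-trans u′≤ρu (ℚ.≤-trans
    (ℚ.*-monoˡ-≤-nonNeg ρ {{ρ≥0}} u≤ρʲg) (ℚ.≤-reflexive (sym (ℚ.*-assoc ρ (ρ ^ℚ j) (ι g)))))

  covered-fraction : ∀ (ρ δ : ℚ) (u c g : ℕ) → u ℕ.+ c ≡ g →
    ι u ≤ ρ * ι g → ρ ≤ 1ℚ - δ → δ * ι g ≤ ι c
  covered-fraction ρ δ u c g u+c≡g u≤ρg ρ≤1-δ = begin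
    δ * G                      ≤⟨ +≤⇒≤- (ℚ.≤-trans (ℚ.+-monoʳ-≤ (δ * G) u≤[1-δ]g) (ℚ.≤-reflexive
                                   (solve 2 (λ δ G → δ :* G :+ (con 1ℚ :- δ) :* G := G) refl δ G))) ⟩
    G - ι u                    ≡⟨ cong (_- ι u) (trans (cong ι (sym u+c≡g)) (ι-+ u c)) ⟩
    (ι u + ι c) - ι u          ≡⟨ solve 2 (λ u c → (u :+ c) :- u := c) refl (ι u) (ι c) ⟩
    ι c                        ∎
    where
    open ℚ.≤-Reasoning
    G = ι g
    u≤[1-δ]g : ι u ≤ (1ℚ - δ) * G
    u≤[1-δ]g = ℚ.≤-trans u≤ρg (ℚ.*-monoʳ-≤-nonNeg G {{ι-nonNeg g}} ρ≤1-δ)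

module Amplification (𝔽 : FiniteField) {n r g : ℕ} (r≤n : r Data.Nat.≤ n)
  (Gr : HasSize (_≐_ 𝔽) (IsGr 𝔽 n r) g) (K : Subset 𝔽 n) where

  open import Data.Nat using (zero; suc; _^_; _≤_; _+_; _*_)
  open import Data.Nat.Properties using (≤-antisym; ≤-trans; ≤-reflexive; +-mono-≤; +-monoˡ-≤; +-comm)
  open import Data.Bool using (false; not; _∨_)
  open import Data.Bool.Properties using (∨-zeroʳ)
  open import Data.Rational as ℚ using (ℚ; 1ℚ)
  import Data.Rational.Properties as ℚ
  open Rationals
  open import Data.Product using (_×_)
  open import Function using (_∘_; mk⇔)
  open import Function.Bundles using (_↔_; Inverse)
  open import Relation.Nullary using (Dec; does; _×-dec_)
  open import Relation.Nullary.Decidable using (dec-true; does-⇔)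
  open import Relation.Binary.Bundles using (Setoid)
  open import Relation.Binary.PropositionalEquality
  open Counting
  open Enumeration using (vec↔; to-injective; from-injective)
  open LinearAlgebra 𝔽
  open Subspaces 𝔽
  open HasSize Gr renaming (elt to S; elt-in to S-in; elt-inj to S-inj; elt-onto to S-onto)

  covers : Subset 𝔽 n → Fin g → Bool
  covers X i = does (TranslateIn? (S i) X)

  Covered-size : ∀ X → HasSize (_≐_ 𝔽) (λ T → IsGr 𝔽 n r T × TranslateIn 𝔽 T X) (count (covers X))
  Covered-size X = size-cong (λ T (T-gr , T-cov) → T-gr , dec-sound (TranslateIn? T X) T-cov)
                             (λ T (T-gr , T-cov) → T-gr , dec-true (TranslateIn? T X) T-cov)
                             (size-filter Gr (λ T → does (TranslateIn? T X)) TranslateIn?-cong)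
    where
    TranslateIn?-cong : ∀ {T T′} → T ≗ T′ → does (TranslateIn? T X) ≡ does (TranslateIn? T′ X)
    TranslateIn?-cong {T} {T′} T≗T′ =
      does-⇔ (mk⇔ (TranslateIn-cong {K = X} T≗T′) (TranslateIn-cong {K = X} (sym ∘ T≗T′)))
             (TranslateIn? T X) (TranslateIn? T′ X)

  Mat↔ : Fin ((FiniteField.q 𝔽 ^ n) ^ n) ↔ Mat n
  Mat↔ = vec↔ (Pt↔ n) n

  open Inverse Mat↔ using (strictlyInverseˡ) renaming (to to matrix; from to index)

  Moves : Fin g → Fin g → Mat n → Set
  Moves j i M = GL M × pull M (S j) ≗ S i

  Moves? : ∀ j i M → Dec (Moves j i M)
  Moves? j i M = GL? M ×-dec (pull M (S j) ≗? S i)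

  invertible : Fin _ → Bool
  invertible m = does (GL? (matrix m))

  moves : Fin g → Fin g → Fin _ → Bool
  moves j i m = does (Moves? j i (matrix m))

  covered-by : Fin _ → Fin g → Bool
  covered-by m = covers (pull (matrix m) K)

  source : ∀ i m → invertible m ≡ true → ∃ λ j → moves j i m ≡ true
  source i m M-inv′
    with M-inv ← dec-sound (GL? (matrix m)) M-inv′
    with N , N-inv , NM≗id ← GL-inverse M-inv
    with j , Sj≗NSi ← S-onto (pull N (S i)) (IsGr-pull N-inv (S-in i))
    = j , dec-true (Moves? j i (matrix m))
                   (M-inv , λ x → trans (Sj≗NSi (⟦ matrix m ⟧ x)) (cong (S i) (NM≗id x)))

  source-unique : ∀ {i m} j j′ → moves j i m ≡ true → moves j′ i m ≡ true → j ≡ j′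
  source-unique {i} {m} j j′ j↦i j′↦i
    with M-inv , MSj≗Si ← dec-sound (Moves? j i (matrix m)) j↦i
    with _ , MSj′≗Si ← dec-sound (Moves? j′ i (matrix m)) j′↦i
    = S-inj j j′ λ y → let x , Mx≡y = ⟦⟧-surjective M-inv y in
        trans (cong (S j) (sym Mx≡y)) (trans (MSj≗Si x) (trans (sym (MSj′≗Si x)) (cong (S j′) Mx≡y)))

  fibre-≤ : ∀ {i j j₀} (P : Mat n) → GL P → pull P (S j₀) ≗ S j → count (moves j i) ≤ count (moves j₀ i)
  fibre-≤ {i} {j} {j₀} P P-inv PSj₀≗Sj =
    size-≤ isEquivalence (count-size (moves j₀ i)) (index ∘ (P ∙_) ∘ M) moved
      λ k k′ eq → select-injective (moves j i) k k′
        (to-injective Mat↔ (∙-cancelˡ P-inv (from-injective Mat↔ eq)))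
    where
    M : Fin (count (moves j i)) → Mat n
    M = matrix ∘ select (moves j i)
    moved : ∀ k → moves j₀ i (index (P ∙ M k)) ≡ true
    moved k =
      let M-inv , MSj≗Si = dec-sound (Moves? j i (M k)) (select-true (moves j i) k) in
      subst (λ Q → does (Moves? j₀ i Q) ≡ true) (sym (strictlyInverseˡ (P ∙ M k)))
        (dec-true (Moves? j₀ i (P ∙ M k))
          (GL-∙ P-inv M-inv , λ x → trans (cong (S j₀) (⟦∙⟧ P (M k) x))
                                          (trans (PSj₀≗Sj (⟦ M k ⟧ x)) (MSj≗Si x))))

  fibres-equal : ∀ i j → count (moves j i) ≡ count (moves i i)
  fibres-equal i j =
    let P , P-inv , PSi≗Sj = pull-transitive r≤n (S-in i) (S-in j)
        P′ , P′-inv , P′Sj≗Si = pull-transitive r≤n (S-in j) (S-in i)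
    in ≤-antisym (fibre-≤ P P-inv PSi≗Sj) (fibre-≤ P′ P′-inv P′Sj≗Si)

  transport : ∀ {i j m} → covers K j ≡ true → moves j i m ≡ true → invertible m ∧ covered-by m i ≡ true
  transport {i} {j} {m} Sj-covered j↦i =
    let M-inv , MSj≗Si = dec-sound (Moves? j i (matrix m)) j↦i in
    dec-true (GL? (matrix m) ×-dec TranslateIn? (S i) (pull (matrix m) K))
      (M-inv , TranslateIn-cong {K = pull (matrix m) K} MSj≗Si
                 (TranslateIn-pull {S = S j} {K} M-inv (dec-sound (TranslateIn? (S j) K) Sj-covered)))

  invertible-exists : ∃ λ m → invertible m ≡ true
  invertible-exists = index I , dec-true (GL? (matrix (index I))) (subst GL (sym (strictlyInverseˡ I)) GL-I)

  open TransitiveAveraging invertible moves (covers K) covered-by source source-unique fibres-equal transport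
    using (averaging-step)

  covered-≤-count : ∀ {c} → HasSize (_≐_ 𝔽) (λ T → IsGr 𝔽 n r T × TranslateIn 𝔽 T K) c → c ≤ count (covers K)
  covered-≤-count Covered = size-≤ (Setoid.isEquivalence (Pt 𝔽 n →-setoid Bool)) (Covered-size K) elt elt-in elt-inj
    where open HasSize Covered

  covers-∪ˡ : ∀ {X Y : Subset 𝔽 n} {i} → covers X i ≡ true → covers (λ x → X x ∨ Y x) i ≡ true
  covers-∪ˡ {X} {Y} {i} X-covers = dec-true (TranslateIn? (S i) (λ x → X x ∨ Y x))
    (TranslateIn-mono {K = X} (λ x Xx → cong (_∨ Y x) Xx) (dec-sound (TranslateIn? (S i) X) X-covers))

  covers-∪ʳ : ∀ {X Y : Subset 𝔽 n} {i} → covers Y i ≡ true → covers (λ x → X x ∨ Y x) i ≡ true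
  covers-∪ʳ {X} {Y} {i} Y-covers = dec-true (TranslateIn? (S i) (λ x → X x ∨ Y x))
    (TranslateIn-mono {K = Y} (λ x Yx → trans (cong (X x ∨_) Yx) (∨-zeroʳ (X x)))
                      (dec-sound (TranslateIn? (S i) Y) Y-covers))

  module Iteration (ε : ℚ) (ε≤1 : ε ℚ.≤ 1ℚ) (εg≤c : ε ℚ.* ι g ℚ.≤ ι (count (covers K))) where

    1-ε≥0 : ℚ.NonNegative (1ℚ ℚ.- ε)
    1-ε≥0 = ℚ.nonNegative (ℚ.≤-trans (ℚ.≤-reflexive (sym (ℚ.+-inverseʳ ε))) (ℚ.+-monoˡ-≤ (ℚ.- ε) ε≤1))

    record Stage (j : ℕ) : Set where
      field
        A           : Subset 𝔽 n
        A-size      : size A ≤ j * size K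
        A-uncovered : ι (count (not ∘ covers A)) ℚ.≤ ((1ℚ ℚ.- ε) ^ℚ j) ℚ.* ι g

    start : Stage 0
    start = record
      { A           = λ _ → false
      ; A-size      = ≤-reflexive (size-∅ n)
      ; A-uncovered = ℚ.≤-trans (ι-mono-≤ (count≤N (not ∘ covers (λ _ → false))))
                                (ℚ.≤-reflexive (sym (ℚ.*-identityˡ (ι g))))
      }

    add-copy : ∀ {j} (stage : Stage j) m → invertible m ≡ true →
      let U = not ∘ covers (Stage.A stage) in
      count U * count (covers K) ≤ g * count (λ i → U i ∧ covered-by m i) → Stage (suc j)
    add-copy {j} stage m m-inv gain = record
      { A           = A′
      ; A-size      = ≤-trans (size-∪ A (pull M K)) (≤-trans (+-mono-≤ A-size (size-pull K M-inv))
                                                           (≤-reflexive (+-comm (j * size K) (size K))))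
      ; A-uncovered = decay-iterate (1ℚ ℚ.- ε) j u u′ g 1-ε≥0 A-uncovered
                        (decay ε u u′ a g (count (covers K)) εg≤c shrink gain (count≤N U))
      }
      where
      open Stage stage
      U = not ∘ covers A
      u = count U
      a = count (λ i → U i ∧ covered-by m i)
      M = matrix m
      M-inv = dec-sound (GL? M) m-inv
      A′ : Subset 𝔽 n
      A′ x = A x ∨ pull M K x
      u′ = count (not ∘ covers A′)
      shrink : u′ + a ≤ u
      shrink = ≤-trans (+-monoˡ-≤ a (count-mono {P = not ∘ covers A′} {Q = λ i → U i ∧ not (covered-by m i)}
                                         λ i → not-either (covers-∪ˡ {A} {pull M K}) (covers-∪ʳ {A} {pull M K})))
                       (≤-reflexive (count-split U (covered-by m)))

    next : ∀ {j} → Stage j → Stage (suc j)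
    next stage = let m , m-inv , gain = averaging-step invertible-exists (not ∘ covers (Stage.A stage))
                 in add-copy stage m m-inv gain

    stage : ∀ j → Stage j
    stage zero    = start
    stage (suc j) = next (stage j)

open import Data.Nat using (_≤_; _<_; _*_)
open import Data.Product using (Σ; _×_)
open import Data.Rational using (ℚ; 0ℚ; 1ℚ) renaming (_<_ to _<ℚ_)

lemma2p6 : (𝔽 : FiniteField) (n r : ℕ) → 1 ≤ r → r < n →
    (ε δ : ℚ) → 0ℚ <ℚ ε → ε <ℚ δ → δ <ℚ 1ℚ →
    (K : Subset 𝔽 n) (kK : ℕ) → Card 𝔽 K kK → IsKakeya 𝔽 n r ε K →
    (m : ℕ) → IsCeilLogRatio ε δ m →
    Σ (Subset 𝔽 n) λ A → Σ ℕ λ kA →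
      Card 𝔽 A kA × IsKakeya 𝔽 n r δ A × kA ≤ m * kK
lemma2p6 𝔽 n r _ r<n ε δ _ ε<δ δ<1 K kK K-card (g , c , Gr , K-covered , εg≤c) m (ρᵐ≤1-δ , _) =
  A , size A , size-Card A ,
  (g , count (covers A) , Gr , Covered-size A ,
   covered-fraction ((1ℚ ℚ.- ε) ^ℚ m) δ (count (not ∘ covers A)) (count (covers A)) g
     (count-complement (covers A)) A-uncovered ρᵐ≤1-δ) ,
  ≤-trans A-size (*-monoʳ-≤ m (Card⇒size≤ K-card))
  where
  open import Data.Nat.Properties using (<⇒≤; ≤-trans; *-monoʳ-≤)
  import Data.Rational as ℚ
  import Data.Rational.Properties as ℚ
  open import Data.Bool using (not)
  open import Function using (_∘_)
  open Counting using (count; count-complement)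
  open Subspaces 𝔽 using (size; size-Card; Card⇒size≤)
  open Rationals using (ι-mono-≤; covered-fraction)
  open Amplification 𝔽 (<⇒≤ r<n) Gr K
  open Iteration ε (ℚ.<⇒≤ (ℚ.<-trans ε<δ δ<1)) (ℚ.≤-trans εg≤c (ι-mono-≤ (covered-≤-count K-covered)))
  open Stage (stage m)
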